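{- Let $S$ be a numerical semigroup with embedding dimension $e(S)=2$. Then $S$ is reflective if and only if there is $n\in\mathbb{N}_0$ such that either $S=\langle 2,4n+3\rangle$ (in which case the genus is $g=2n+1$) or $S=\langle 3,3n+2\rangle$ (in which case $g=3n+1$).
   Context: A numerical semigroup is a submonoid $S$ of $(\mathbb{N}_0,+)$ with finite complement; its genus is $g(S)=\#(\mathbb{N}_0\setminus S)$; its embedding dimension $e(S)$ is the size of its minimal generating set. $\langle a,b\rangle=\{ua+vb: u,v\in\mathbb{N}_0\}$. A numerical semigroup $S$ of genus $g\ge1$ is reflective if for every integer $z$ with $0\le z\le g-1$ exactly one of $z$ and $z+g$ lies in $S$. -}

module Defs where

open import Data.Nat using (ℕ; zero; suc; _+_; _*_; _≤_; _<_; _≥_)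
open import Data.Bool using (Bool; true; false; not; _xor_)
open import Data.List using (List; filter; length; upTo)
open import Data.Product using (Σ; ∃; ∃-syntax; _×_; _,_; proj₁)
open import Relation.Binary.PropositionalEquality using (_≡_; _≢_)
open import Relation.Nullary using (¬_)
open import Function.Bundles using (_⇔_)
open import Data.Bool.Properties using (T?)

Subset : Set
Subset = ℕ → Bool

_∈_ : ℕ → Subset → Set
x ∈ S = S x ≡ true

infix 4 _∈_

record IsNumericalSemigroup (S : Subset) : Set where
  field
    zero∈  : 0 ∈ S
    +-closed : ∀ x y → x ∈ S → y ∈ S → (x + y) ∈ S
    bound  : ℕ
    cofinite : ∀ x → bound ≤ x → x ∈ S

-- Genus: number of gaps (all gaps are below `bound`).
genus : (S : Subset) → IsNumericalSemigroup S → ℕ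
genus S ns = length (filter (λ x → T? (not (S x))) (upTo (IsNumericalSemigroup.bound ns)))

IsMinimalGenerator : Subset → ℕ → Set
IsMinimalGenerator S x =
  x ≢ 0 × x ∈ S ×
  ¬ (∃[ a ] ∃[ b ] (a ≢ 0 × b ≢ 0 × a ∈ S × b ∈ S × a + b ≡ x))

EmbeddingDimension2 : Subset → Set
EmbeddingDimension2 S =
  ∃[ a ] ∃[ b ] (a < b × IsMinimalGenerator S a × IsMinimalGenerator S b ×
                 (∀ x → IsMinimalGenerator S x → x ≡ a Data.Sum.⊎ x ≡ b))
  where import Data.Sum

IsGeneratedBy : Subset → ℕ → ℕ → Set
IsGeneratedBy S a b = ∀ x → (x ∈ S ⇔ (∃[ u ] ∃[ v ] (u * a + v * b ≡ x)))

IsReflective : (S : Subset) → IsNumericalSemigroup S → Set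
IsReflective S ns = 1 ≤ genus S ns × (∀ z → z < genus S ns → (S z xor S (z + genus S ns)) ≡ true)

-- Minimal generators generate S, so embedding dimension two means S = ⟨a,b⟩ with a < b and a ∤ b.
-- Reflectivity pairs each z < g with z + g, so [0, 2g) already contains all g gaps and S is full
-- from 2g on; moreover g ∉ S, and stripping copies of a from b shows g < b. For 0 < j < a the
-- numbers j + g are then elements of ⟨a,b⟩ below 2b, hence congruent to 0 or b modulo a, which
-- forces a ≤ 3. For a = 2 parity pins b to 2g + 1; for a = 3 comparing b with g + 1 and g + 2
-- gives b = g + 1 and rules out g ≡ 2 (mod 3). Conversely, for ⟨2,4n+3⟩ and ⟨3,3n+2⟩ the pairing
-- and fullness beyond 2g are checked residue by residue, and counting gaps gives the genus.

module Submission where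

open import Defs
open import Data.Bool using (Bool; true; false; not; _xor_; if_then_else_) renaming (_≟_ to _≟ᵇ_)
open import Data.Bool.Properties using (T?; ¬-not)
open import Data.Empty using (⊥; ⊥-elim)
open import Data.Fin using (zero; suc; toℕ)
open import Data.Fin.Properties using (toℕ<n)
open import Data.List using (filter; length; applyUpTo)
open import Data.Nat
open import Data.Nat.DivMod using (_divMod_; result; [m+kn]%n≡m%n; m<n⇒m%n≡m)
open import Data.Nat.Divisibility using (_∣_; divides; ∣m+n∣m⇒∣n; ∣⇒≤)
open import Data.Nat.Induction using (<-rec)
open import Data.Nat.Properties
open import Data.Nat.Tactic.RingSolver using (solve-∀)
open import Data.Product using (_×_; _,_; proj₁; proj₂; ∃-syntax)
open import Data.Sum using (_⊎_; inj₁; inj₂)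
open import Function.Bundles using (_⇔_; mk⇔; Equivalence)
open import Relation.Binary.Definitions using (tri<; tri≈; tri>)
open import Relation.Binary.PropositionalEquality
open import Relation.Nullary using (¬_; Dec; yes; no; ¬?; _×-dec_; map′; contradiction)

remainder-unique : ∀ {d r s q p} → r < d → s < d → r + q * d ≡ s + p * d → r ≡ s
remainder-unique {suc d} {r} {s} {q} {p} r<d s<d eq = begin
  r                       ≡⟨ m<n⇒m%n≡m r<d ⟨
  r % suc d               ≡⟨ [m+kn]%n≡m%n r q (suc d) ⟨
  (r + q * suc d) % suc d ≡⟨ cong (_% suc d) eq ⟩
  (s + p * suc d) % suc d ≡⟨ [m+kn]%n≡m%n s p (suc d) ⟩
  s % suc d               ≡⟨ m<n⇒m%n≡m s<d ⟩
  s                       ∎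
  where open ≡-Reasoning

∤-nonzero-remainder : ∀ {d r q} → 0 < r → r < d → ¬ d ∣ r + q * d
∤-nonzero-remainder {q = q} 0<r r<d (divides p eq) =
  <⇒≢ 0<r (sym (remainder-unique {q = q} {p = p} r<d (<-trans 0<r r<d) eq))

odd⇒2∣suc : ∀ {x} → ¬ 2 ∣ x → 2 ∣ suc x
odd⇒2∣suc {x} 2∤x with x divMod 2
... | result q zero       x≡2q   = ⊥-elim (2∤x (divides q x≡2q))
... | result q (suc zero) x≡1+2q = divides (suc q) (cong suc x≡1+2q)

pigeonhole-≤1 : ∀ {v₁ v₂ v₃} → v₁ ≤ 1 → v₂ ≤ 1 → v₃ ≤ 1 → v₁ ≡ v₂ ⊎ v₁ ≡ v₃ ⊎ v₂ ≡ v₃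
pigeonhole-≤1 z≤n       z≤n       _         = inj₁ refl
pigeonhole-≤1 (s≤s z≤n) (s≤s z≤n) _         = inj₁ refl
pigeonhole-≤1 z≤n       (s≤s z≤n) z≤n       = inj₂ (inj₁ refl)
pigeonhole-≤1 z≤n       (s≤s z≤n) (s≤s z≤n) = inj₂ (inj₂ refl)
pigeonhole-≤1 (s≤s z≤n) z≤n       z≤n       = inj₂ (inj₂ refl)
pigeonhole-≤1 (s≤s z≤n) z≤n       (s≤s z≤n) = inj₂ (inj₁ refl)

≡true⇒≢false : ∀ {p} → p ≡ true → p ≢ false
≡true⇒≢false refl ()

xor-true-left : ∀ {p q} → p ≡ true → (p xor q) ≡ true → q ≡ false
xor-true-left {q = false} _    _  = refl
xor-true-left {q = true}  refl ()

xor-false-left : ∀ {p q} → p ≡ false → (p xor q) ≡ true → q ≡ true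
xor-false-left {q = true}  _    _  = refl
xor-false-left {q = false} refl ()

xor-true-false : ∀ {p q} → p ≡ true → q ≡ false → (p xor q) ≡ true
xor-true-false refl refl = refl

xor-false-true : ∀ {p q} → p ≡ false → q ≡ true → (p xor q) ≡ true
xor-false-true refl refl = refl

-- Counting gaps

gaps : (ℕ → Bool) → ℕ → ℕ
gaps f zero    = 0
gaps f (suc n) = (if f 0 then 0 else 1) + gaps (λ x → f (suc x)) n

gaps-applyUpTo : ∀ (f : ℕ → Bool) h n →
  length (filter (λ x → T? (not (f x))) (applyUpTo h n)) ≡ gaps (λ x → f (h x)) n
gaps-applyUpTo f h zero = refl
gaps-applyUpTo f h (suc n) with f (h 0)
... | true  = gaps-applyUpTo f (λ x → h (suc x)) n
... | false = cong suc (gaps-applyUpTo f (λ x → h (suc x)) n)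

gaps-+ : ∀ f m n → gaps f (m + n) ≡ gaps f m + gaps (λ x → f (m + x)) n
gaps-+ f zero    n = refl
gaps-+ f (suc m) n =
  trans (cong (first +_) (gaps-+ (λ x → f (suc x)) m n)) (sym (+-assoc first _ _))
  where first = if f 0 then 0 else 1

gaps-all-true : ∀ f n → (∀ x → f x ≡ true) → gaps f n ≡ 0
gaps-all-true f zero    _   = refl
gaps-all-true f (suc n) all rewrite all 0 = gaps-all-true (λ x → f (suc x)) n (λ x → all (suc x))

gaps-true-beyond : ∀ f m n → (∀ t → f (m + t) ≡ true) → gaps f (m + n) ≡ gaps f m
gaps-true-beyond f m n all = begin
  gaps f (m + n)                        ≡⟨ gaps-+ f m n ⟩
  gaps f m + gaps (λ x → f (m + x)) n   ≡⟨ cong (gaps f m +_) (gaps-all-true _ n all) ⟩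
  gaps f m + 0                          ≡⟨ +-identityʳ _ ⟩
  gaps f m                              ∎
  where open ≡-Reasoning

gaps-pos : ∀ f {x} n → f x ≡ false → x < n → 0 < gaps f n
gaps-pos f {zero}  (suc n) fx≡false _ rewrite fx≡false = z<s
gaps-pos f {suc x} (suc n) fx≡false (s≤s x<n) =
  <-≤-trans (gaps-pos (λ y → f (suc y)) n fx≡false x<n) (m≤n+m _ _)

gaps-<-gap : ∀ f m {x} n → f (m + x) ≡ false → x < n → gaps f m < gaps f (m + n)
gaps-<-gap f m n gap x<n =
  subst (gaps f m <_) (sym (gaps-+ f m n)) (m<m+n _ (gaps-pos (λ y → f (m + y)) n gap x<n))

ReflectiveAt : Subset → ℕ → Set
ReflectiveAt S g = ∀ z → z < g → (S z xor S (z + g)) ≡ true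

gaps-complementary : ∀ f h n → (∀ z → z < n → (f z xor h z) ≡ true) → gaps f n + gaps h n ≡ n
gaps-complementary f h zero    _   = refl
gaps-complementary f h (suc n) one =
  trans (regroup (if f 0 then 0 else 1) (gaps f′ n) (if h 0 then 0 else 1) (gaps h′ n))
        (cong₂ _+_ (first (one 0 z<s)) (gaps-complementary f′ h′ n (λ z z<n → one (suc z) (s<s z<n))))
  where
  f′ = λ x → f (suc x)
  h′ = λ x → h (suc x)
  regroup : ∀ p q r s → (p + q) + (r + s) ≡ (p + r) + (q + s)
  regroup = solve-∀
  first : (f 0 xor h 0) ≡ true → (if f 0 then 0 else 1) + (if h 0 then 0 else 1) ≡ 1
  first _ with f 0 | h 0
  first _  | true  | false = refl
  first _  | false | true  = refl
  first () | true  | true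
  first () | false | false

gaps-reflectiveAt : ∀ S g → ReflectiveAt S g → gaps S (g + g) ≡ g
gaps-reflectiveAt S g one = trans (gaps-+ S g g) (gaps-complementary S (λ x → S (g + x)) g one′)
  where
  one′ : ∀ z → z < g → (S z xor S (g + z)) ≡ true
  one′ z z<g = subst (λ y → (S z xor S y) ≡ true) (+-comm z g) (one z z<g)

module NumericalSemigroup {S : Subset} (ns : IsNumericalSemigroup S) where
  open IsNumericalSemigroup ns

  *-∈ : ∀ q {x} → x ∈ S → (q * x) ∈ S
  *-∈ zero    _   = zero∈
  *-∈ (suc q) x∈S = +-closed _ _ x∈S (*-∈ q x∈S)

  genus≡gaps : ∀ m → (∀ t → (m + t) ∈ S) → genus S ns ≡ gaps S m
  genus≡gaps m full = begin
    genus S ns          ≡⟨ gaps-applyUpTo S (λ x → x) bound ⟩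
    gaps S bound        ≡⟨ gaps-true-beyond S bound m (λ t → cofinite _ (m≤m+n bound t)) ⟨
    gaps S (bound + m)  ≡⟨ cong (gaps S) (+-comm bound m) ⟩
    gaps S (m + bound)  ≡⟨ gaps-true-beyond S m bound full ⟩
    gaps S m            ∎
    where open ≡-Reasoning

  genus-reflectiveAt : ∀ g → ReflectiveAt S g → (∀ t → (g + g + t) ∈ S) → genus S ns ≡ g
  genus-reflectiveAt g one full = trans (genus≡gaps (g + g) full) (gaps-reflectiveAt S g one)

  reflectiveAt⇒reflective : ∀ {g} → 0 < g → ReflectiveAt S g → (∀ t → (g + g + t) ∈ S) →
                            IsReflective S ns
  reflectiveAt⇒reflective {g} 0<g one full rewrite genus-reflectiveAt g one full = 0<g , one

module Reflective {S : Subset} (ns : IsNumericalSemigroup S) (reflective : IsReflective S ns) where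
  open IsNumericalSemigroup ns
  open NumericalSemigroup ns

  g : ℕ
  g = genus S ns

  ∈⇒shift∉ : ∀ {z} → z < g → z ∈ S → S (z + g) ≡ false
  ∈⇒shift∉ z<g z∈S = xor-true-left z∈S (proj₂ reflective _ z<g)

  ∉⇒shift∈ : ∀ {z} → z < g → S z ≡ false → (z + g) ∈ S
  ∉⇒shift∈ z<g z∉S = xor-false-left z∉S (proj₂ reflective _ z<g)

  g∉S : S g ≡ false
  g∉S = ∈⇒shift∉ (proj₁ reflective) zero∈

  -- A gap beyond 2g would be a (g+1)-st gap, since [0, 2g) already contains g of them.
  full-from-2g : ∀ t → (g + g + t) ∈ S
  full-from-2g t with S (g + g + t) in gap
  ... | true  = refl
  ... | false = ⊥-elim (<-irrefl refl (begin-strict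
      g                      ≡⟨ gaps-reflectiveAt S g (proj₂ reflective) ⟨
      gaps S (g + g)         <⟨ gaps-<-gap S (g + g) (suc t + bound) gap (s≤s (m≤m+n t bound)) ⟩
      gaps S (g + g + n)     ≡⟨ genus≡gaps (g + g + n) beyond ⟨
      g                      ∎))
    where
    open ≤-Reasoning
    n = suc t + bound
    beyond : ∀ s → (g + g + n + s) ∈ S
    beyond s = cofinite _ (≤-trans (m≤n+m bound (suc t)) (≤-trans (m≤n+m n (g + g)) (m≤m+n _ s)))

  ∈-cancelˡ : ∀ {c y} → c ∈ S → c + y < g → (c + y) ∈ S → y ∈ S
  ∈-cancelˡ {c} {y} c∈S c+y<g c+y∈S with S y in y∈S
  ... | true  = refl
  ... | false = ⊥-elim (≡true⇒≢false (subst (_∈ S) (sym (+-assoc c y g)) sum∈S) (∈⇒shift∉ c+y<g c+y∈S))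
    where
    sum∈S : (c + (y + g)) ∈ S
    sum∈S = +-closed c (y + g) c∈S (∉⇒shift∈ (≤-<-trans (m≤n+m y c) c+y<g) y∈S)

  ∈-cancel-multiples : ∀ {c r} q → c ∈ S → r + q * c < g → (r + q * c) ∈ S → r ∈ S
  ∈-cancel-multiples {c} {r} zero    _   _   r∈S = subst (_∈ S) (+-identityʳ r) r∈S
  ∈-cancel-multiples {c} {r} (suc q) c∈S small r∈S =
    ∈-cancel-multiples q c∈S (≤-<-trans (m≤n+m _ c) small′)
                       (∈-cancelˡ c∈S small′ (subst (_∈ S) (move r q c) r∈S))
    where
    move : ∀ r q c → r + suc q * c ≡ c + (r + q * c)
    move = solve-∀
    small′ : c + (r + q * c) < g
    small′ = subst (_< g) (move r q c) small

-- Semigroups generated by two elements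

_∈⟨_,_⟩ : ℕ → ℕ → ℕ → Set
x ∈⟨ a , b ⟩ = ∃[ u ] ∃[ v ] (u * a + v * b ≡ x)

∈⟨⟩-+ : ∀ {a b x y} → x ∈⟨ a , b ⟩ → y ∈⟨ a , b ⟩ → (x + y) ∈⟨ a , b ⟩
∈⟨⟩-+ {a} {b} (u , v , refl) (u′ , v′ , refl) = u + u′ , v + v′ , regroup u u′ v v′ a b
  where
  regroup : ∀ u u′ v v′ a b → (u + u′) * a + (v + v′) * b ≡ (u * a + v * b) + (u′ * a + v′ * b)
  regroup = solve-∀

∈⟨⟩-below-b : ∀ {a b x} → x ∈⟨ a , b ⟩ → x < b → a ∣ x
∈⟨⟩-below-b {a} {b} (u , zero  , refl) _   = divides u (+-identityʳ (u * a))
∈⟨⟩-below-b {a} {b} (u , suc v , refl) x<b =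
  contradiction (≤-trans (m≤m+n b (v * b)) (m≤n+m _ (u * a))) (<⇒≱ x<b)

∈⟨⟩-∤⇒b≤ : ∀ {a b x} → x ∈⟨ a , b ⟩ → ¬ a ∣ x → b ≤ x
∈⟨⟩-∤⇒b≤ x∈ a∤x = ≮⇒≥ (λ x<b → a∤x (∈⟨⟩-below-b x∈ x<b))

∈⟨⟩-below-a : ∀ {a b x} → a ≤ b → x ∈⟨ a , b ⟩ → x < a → x ≡ 0
∈⟨⟩-below-a {x = zero}  _   _  _   = refl
∈⟨⟩-below-a {x = suc x} a≤b x∈ x<a =
  contradiction (∣⇒≤ (∈⟨⟩-below-b x∈ (<-≤-trans x<a a≤b))) (<⇒≱ x<a)

b-coefficient-below-2b : ∀ {a b} u {v x} → u * a + v * b ≡ x → x < b + b → v ≤ 1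
b-coefficient-below-2b u {zero}     _    _      = z≤n
b-coefficient-below-2b u {suc zero} _    _      = s≤s z≤n
b-coefficient-below-2b {a} {b} u {suc (suc v)} refl x<2b =
  contradiction (≤-trans (≤-trans (m≤m+n (b + b) (v * b)) (≤-reflexive (+-assoc b b (v * b))))
                         (m≤n+m _ (u * a)))
                (<⇒≱ x<2b)

same-b-coefficient⇒∣ : ∀ {a b} u u′ {v v′ d x} → v ≡ v′ →
                       u * a + v * b ≡ x → u′ * a + v′ * b ≡ d + x → a ∣ d
same-b-coefficient⇒∣ {a} {b} u u′ {v} {d = d} refl refl eq′ =
  ∣m+n∣m⇒∣n (divides u′ (+-cancelʳ-≡ (v * b) _ _ (trans (regroup (u * a) d (v * b)) (sym eq′))))
            (divides u refl)
  where
  regroup : ∀ p q r → p + q + r ≡ q + (p + r)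
  regroup = solve-∀

module Generated {S : Subset} {a b : ℕ} (S≡⟨a,b⟩ : IsGeneratedBy S a b) where

  ∈⇒∈⟨⟩ : ∀ {x} → x ∈ S → x ∈⟨ a , b ⟩
  ∈⇒∈⟨⟩ = Equivalence.to (S≡⟨a,b⟩ _)

  ∈⟨⟩⇒∈ : ∀ {x} → x ∈⟨ a , b ⟩ → x ∈ S
  ∈⟨⟩⇒∈ = Equivalence.from (S≡⟨a,b⟩ _)

  ∉⟨⟩⇒∉ : ∀ {x} → ¬ x ∈⟨ a , b ⟩ → S x ≡ false
  ∉⟨⟩⇒∉ x∉ = ¬-not (λ x∈S → x∉ (∈⇒∈⟨⟩ x∈S))

  ∣⇒∈ : ∀ {x} → a ∣ x → x ∈ S
  ∣⇒∈ (divides q refl) = ∈⟨⟩⇒∈ (q , 0 , +-identityʳ _)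

  ∉-below-b : ∀ {x} → x < b → ¬ a ∣ x → S x ≡ false
  ∉-below-b x<b a∤x = ∉⟨⟩⇒∉ (λ x∈ → a∤x (∈⟨⟩-below-b x∈ x<b))

Decomposable : Subset → ℕ → Set
Decomposable S x = ∃[ c ] ∃[ d ] (c ≢ 0 × d ≢ 0 × c ∈ S × d ∈ S × c + d ≡ x)

decomposable? : ∀ S x → Dec (Decomposable S x)
decomposable? S x = map′ split unsplit (anyUpTo? part? x)
  where
  Part : ℕ → Set
  Part c = c ≢ 0 × c ∈ S × (x ∸ c) ∈ S
  part? : ∀ c → Dec (Part c)
  part? c = ¬? (c ≟ 0) ×-dec (S c ≟ᵇ true) ×-dec (S (x ∸ c) ≟ᵇ true)
  split : ∃[ c ] (c < x × Part c) → Decomposable S x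
  split (c , c<x , c≢0 , c∈S , rest∈S) =
    c , x ∸ c , c≢0 , >⇒≢ (m<n⇒0<n∸m c<x) , c∈S , rest∈S , m+[n∸m]≡n (<⇒≤ c<x)
  unsplit : Decomposable S x → ∃[ c ] (c < x × Part c)
  unsplit (c , d , c≢0 , d≢0 , c∈S , d∈S , c+d≡x) =
    c , subst (c <_) c+d≡x (m<m+n c (n≢0⇒n>0 d≢0)) , c≢0 , c∈S ,
    subst (_∈ S) (trans (sym (m+n∸m≡n c d)) (cong (_∸ c) c+d≡x)) d∈S

module TwoMinimalGenerators
  {S : Subset} (ns : IsNumericalSemigroup S) {a b : ℕ}
  (a-min : IsMinimalGenerator S a) (b-min : IsMinimalGenerator S b)
  (only : ∀ x → IsMinimalGenerator S x → x ≡ a ⊎ x ≡ b) where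
  open IsNumericalSemigroup ns
  open NumericalSemigroup ns

  a∈S : a ∈ S
  a∈S = proj₁ (proj₂ a-min)

  b∈S : b ∈ S
  b∈S = proj₁ (proj₂ b-min)

  ∈⟨⟩⇒∈ : ∀ {x} → x ∈⟨ a , b ⟩ → x ∈ S
  ∈⟨⟩⇒∈ (u , v , refl) = +-closed _ _ (*-∈ u a∈S) (*-∈ v b∈S)

  ∈⇒∈⟨⟩ : ∀ x → x ∈ S → x ∈⟨ a , b ⟩
  ∈⇒∈⟨⟩ = <-rec (λ x → x ∈ S → x ∈⟨ a , b ⟩) step
    where
    step : ∀ x → (∀ {y} → y < x → y ∈ S → y ∈⟨ a , b ⟩) → x ∈ S → x ∈⟨ a , b ⟩
    step x rec x∈S with x ≟ 0 | decomposable? S x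
    ... | yes refl | _ = 0 , 0 , refl
    ... | no x≢0 | yes (c , d , c≢0 , d≢0 , c∈S , d∈S , refl) =
      ∈⟨⟩-+ (rec (m<m+n c (n≢0⇒n>0 d≢0)) c∈S) (rec (m<n+m d (n≢0⇒n>0 c≢0)) d∈S)
    ... | no x≢0 | no indecomposable with only x (x≢0 , x∈S , indecomposable)
    ...   | inj₁ refl = 1 , 0 , trans (+-identityʳ _) (+-identityʳ x)
    ...   | inj₂ refl = 0 , 1 , +-identityʳ x

  generated : IsGeneratedBy S a b
  generated x = mk⇔ (∈⇒∈⟨⟩ x) ∈⟨⟩⇒∈

  a∤b : a < b → ¬ a ∣ b
  a∤b a<b (divides zero          b≡0)   = proj₁ b-min b≡0
  a∤b a<b (divides (suc zero)    b≡a+0) = <⇒≢ a<b (sym (trans b≡a+0 (+-identityʳ a)))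
  a∤b a<b (divides (suc (suc q)) b≡)    = proj₂ (proj₂ b-min)
    (a , suc q * a , proj₁ a-min , (λ e → proj₁ a-min (m+n≡0⇒m≡0 a e)) , a∈S , *-∈ (suc q) a∈S , sym b≡)

-- Reflective semigroups of embedding dimension two

module ReflectiveTwoGenerated
  {S : Subset} (ns : IsNumericalSemigroup S) (reflective : IsReflective S ns)
  {a b : ℕ} .{{_ : NonZero a}} (a<b : a < b) (a∤b : ¬ a ∣ b) (S≡⟨a,b⟩ : IsGeneratedBy S a b) where
  open IsNumericalSemigroup ns
  open Reflective ns reflective public
  open Generated S≡⟨a,b⟩ public

  a∈S : a ∈ S
  a∈S = ∣⇒∈ (divides 1 (sym (+-identityʳ a)))

  a∤g : ¬ a ∣ g
  a∤g a∣g = ≡true⇒≢false (∣⇒∈ a∣g) g∉S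

  b∈S : b ∈ S
  b∈S = ∈⟨⟩⇒∈ (0 , 1 , +-identityʳ b)

  ∈-below-a : ∀ {x} → x < a → x ∈ S → x ≡ 0
  ∈-below-a x<a x∈S = ∈⟨⟩-below-a (<⇒≤ a<b) (∈⇒∈⟨⟩ x∈S) x<a

  1<a : 1 < a
  1<a = ≤∧≢⇒< (>-nonZero⁻¹ a)
              (λ a≡1 → a∤g (divides g (sym (trans (cong (g *_) (sym a≡1)) (*-identityʳ g)))))

  -- If b < g, stripping copies of a from b stays inside S and leaves the remainder of b mod a in S below a.
  g<b : g < b
  g<b with <-cmp g b | b divMod a
  ... | tri< g<b _ _ | _ = g<b
  ... | tri≈ _ g≡b _ | _ = ⊥-elim (≡true⇒≢false b∈S (subst (λ y → S y ≡ false) g≡b g∉S))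
  ... | tri> _ _ b<g | result q r b≡r+qa = ⊥-elim (a∤b (divides q (trans b≡r+qa (cong (_+ q * a) r≡0))))
    where
    r≡0 : toℕ r ≡ 0
    r≡0 = ∈-below-a (toℕ<n r)
      (∈-cancel-multiples q a∈S (subst (_< g) b≡r+qa b<g) (subst (_∈ S) b≡r+qa b∈S))

  shift∈ : ∀ {j} → 0 < j → j < a → (j + g) ∈ S
  shift∈ {j} 0<j j<a with j <? g
  ... | yes j<g = ∉⇒shift∈ j<g (¬-not (λ j∈S → >⇒≢ 0<j (∈-below-a j<a j∈S)))
  ... | no  j≮g = subst (_∈ S) (begin
      g + g + (j ∸ g)   ≡⟨ +-assoc g g (j ∸ g) ⟩
      g + (g + (j ∸ g)) ≡⟨ cong (g +_) (m+[n∸m]≡n (≮⇒≥ j≮g)) ⟩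
      g + j             ≡⟨ +-comm g j ⟩
      j + g             ∎) (full-from-2g (j ∸ g))
    where open ≡-Reasoning

  shift-rep : ∀ {j} → 0 < j → j < a → ∃[ u ] ∃[ v ] (v ≤ 1 × u * a + v * b ≡ j + g)
  shift-rep 0<j j<a with ∈⇒∈⟨⟩ (shift∈ 0<j j<a)
  ... | u , v , e = u , v , b-coefficient-below-2b u e (+-mono-< (<-trans j<a a<b) g<b) , e

  -- Two of 1 + g, 2 + g, 3 + g share the coefficient of b, so they differ by a multiple of a.
  a≤3 : a ≤ 3
  a≤3 = ≮⇒≥ λ 3<a → <⇒≱ 3<a (≤-trans (a≤2 (shift-rep {1} z<s (≤-<-trans (s≤s z≤n) 3<a))
                                               (shift-rep {2} z<s (≤-<-trans (s≤s (s≤s z≤n)) 3<a))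
                                               (shift-rep {3} z<s 3<a))
                                           (n≤1+n 2))
    where
    a≤2 : ∃[ u ] ∃[ v ] (v ≤ 1 × u * a + v * b ≡ 1 + g) →
          ∃[ u ] ∃[ v ] (v ≤ 1 × u * a + v * b ≡ 2 + g) →
          ∃[ u ] ∃[ v ] (v ≤ 1 × u * a + v * b ≡ 3 + g) → a ≤ 2
    a≤2 (u₁ , _ , v₁≤1 , e₁) (u₂ , _ , v₂≤1 , e₂) (u₃ , _ , v₃≤1 , e₃) with pigeonhole-≤1 v₁≤1 v₂≤1 v₃≤1
    ... | inj₁ v₁≡v₂        = ≤-trans (∣⇒≤ (same-b-coefficient⇒∣ u₁ u₂ v₁≡v₂ e₁ e₂)) (n≤1+n 1)
    ... | inj₂ (inj₁ v₁≡v₃) = ∣⇒≤ (same-b-coefficient⇒∣ u₁ u₃ v₁≡v₃ e₁ e₃)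
    ... | inj₂ (inj₂ v₂≡v₃) = ≤-trans (∣⇒≤ (same-b-coefficient⇒∣ u₂ u₃ v₂≡v₃ e₂ e₃)) (n≤1+n 1)

module ReflectiveWithMultiplicity2
  {S : Subset} (ns : IsNumericalSemigroup S) (reflective : IsReflective S ns)
  {b : ℕ} (2<b : 2 < b) (2∤b : ¬ 2 ∣ b) (S≡⟨2,b⟩ : IsGeneratedBy S 2 b) where
  open ReflectiveTwoGenerated ns reflective 2<b 2∤b S≡⟨2,b⟩

  b≤2g+1 : b ≤ suc (g + g)
  b≤2g+1 = subst (b ≤_) (+-comm (g + g) 1)
    (∈⟨⟩-∤⇒b≤ (∈⇒∈⟨⟩ (full-from-2g 1))
              (λ 2∣2g+1 → ∤-nonzero-remainder {q = g} z<s (s≤s (s≤s z≤n)) (subst (2 ∣_) (sym (odd g)) 2∣2g+1)))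
    where
    odd : ∀ g → 1 + g * 2 ≡ g + g + 1
    odd = solve-∀

  g+[b∸g]≡b : g + (b ∸ g) ≡ b
  g+[b∸g]≡b = m+[n∸m]≡n (<⇒≤ g<b)

  2∣b∸g : 2 ∣ b ∸ g
  2∣b∸g = ∣m+n∣m⇒∣n (subst (λ y → 2 ∣ suc y) (sym g+[b∸g]≡b) (odd⇒2∣suc 2∤b)) (odd⇒2∣suc a∤g)

  -- The even number b − g cannot lie below g: it would be in S and push b = (b − g) + g out of S.
  2g+1≤b : suc (g + g) ≤ b
  2g+1≤b with <-cmp (b ∸ g) g
  ... | tri< b∸g<g _ _ = ⊥-elim (≡true⇒≢false b∈S (subst (λ y → S y ≡ false) (trans (+-comm (b ∸ g) g) g+[b∸g]≡b)
                                                             (∈⇒shift∉ b∸g<g (∣⇒∈ 2∣b∸g))))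
  ... | tri≈ _ b∸g≡g _ = ⊥-elim (a∤g (subst (2 ∣_) b∸g≡g 2∣b∸g))
  ... | tri> _ _ g<b∸g = subst₂ _≤_ (+-suc g g) g+[b∸g]≡b (+-monoʳ-≤ g g<b∸g)

  b≡4n+3 : ∃[ n ] b ≡ 4 * n + 3
  b≡4n+3 with g divMod 2
  ... | result k zero       g≡2k   = ⊥-elim (a∤g (divides k g≡2k))
  ... | result k (suc zero) g≡1+2k = k , (begin
    b                                   ≡⟨ ≤-antisym b≤2g+1 2g+1≤b ⟩
    suc (g + g)                         ≡⟨ cong₂ (λ x y → suc (x + y)) g≡1+2k g≡1+2k ⟩
    suc ((1 + k * 2) + (1 + k * 2))     ≡⟨ double-odd k ⟩
    4 * k + 3                           ∎)
    where
    open ≡-Reasoning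
    double-odd : ∀ k → suc ((1 + k * 2) + (1 + k * 2)) ≡ 4 * k + 3
    double-odd = solve-∀

module ReflectiveWithMultiplicity3
  {S : Subset} (ns : IsNumericalSemigroup S) (reflective : IsReflective S ns)
  {b : ℕ} (3<b : 3 < b) (3∤b : ¬ 3 ∣ b) (S≡⟨3,b⟩ : IsGeneratedBy S 3 b) where
  open ReflectiveTwoGenerated ns reflective 3<b 3∤b S≡⟨3,b⟩

  b≤j+g : ∀ {j} → 0 < j → j < 3 → ¬ 3 ∣ j + g → b ≤ j + g
  b≤j+g 0<j j<3 = ∈⟨⟩-∤⇒b≤ (∈⇒∈⟨⟩ (shift∈ 0<j j<3))

  -- If g ≡ 2 (mod 3) then b = g + 2, and 2g + 1 < 2b would have residue 2, unlike elements of ⟨3,b⟩ below 2b.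
  g≢2+3k : ∀ k → g ≢ 2 + k * 3
  g≢2+3k k g≡2+3k = impossible (∈⇒∈⟨⟩ (full-from-2g 1))
    where
    open ≡-Reasoning
    3∤2+g : ¬ 3 ∣ 2 + g
    3∤2+g 3∣2+g = ∤-nonzero-remainder {q = suc k} z<s (s≤s (s≤s z≤n)) (subst (λ y → 3 ∣ 2 + y) g≡2+3k 3∣2+g)
    3∣1+g : 3 ∣ 1 + g
    3∣1+g = divides (suc k) (cong suc g≡2+3k)
    b≡2+g : b ≡ 2 + g
    b≡2+g = ≤-antisym (b≤j+g z<s (s≤s (s≤s (s≤s z≤n))) 3∤2+g)
                      (≤∧≢⇒< g<b (λ 1+g≡b → 3∤b (subst (3 ∣_) 1+g≡b 3∣1+g)))
    2g+1<2b : g + g + 1 < b + b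
    2g+1<2b = subst (_< b + b) (sym (+-assoc g g 1))
                (+-mono-< g<b (subst (_< b) (+-comm 1 g) (subst (1 + g <_) (sym b≡2+g) (n<1+n (1 + g)))))
    2g+1≡2+[1+2k]3 : g + g + 1 ≡ 2 + (1 + k * 2) * 3
    2g+1≡2+[1+2k]3 = trans (cong (λ y → y + y + 1) g≡2+3k) (double k)
      where
      double : ∀ k → (2 + k * 3) + (2 + k * 3) + 1 ≡ 2 + (1 + k * 2) * 3
      double = solve-∀
    impossible : (g + g + 1) ∈⟨ 3 , b ⟩ → ⊥
    impossible (u , v , e) with b-coefficient-below-2b {3} {b} u {v} e 2g+1<2b
    ... | z≤n = ∤-nonzero-remainder {q = 1 + k * 2} z<s (s≤s (s≤s (s≤s z≤n)))
                  (divides u (trans (sym 2g+1≡2+[1+2k]3) (trans (sym e) (+-identityʳ (u * 3)))))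
    ... | s≤s z≤n = 1≢2 (remainder-unique {q = u + k + 1} {p = 1 + k * 2} (s≤s (s≤s z≤n)) (s≤s (s≤s (s≤s z≤n))) (begin
      1 + (u + k + 1) * 3                ≡⟨ regroup u k ⟩
      u * 3 + 1 * (2 + (2 + k * 3))      ≡⟨ cong (λ y → u * 3 + 1 * y) (trans b≡2+g (cong (2 +_) g≡2+3k)) ⟨
      u * 3 + 1 * b                      ≡⟨ e ⟩
      g + g + 1                          ≡⟨ 2g+1≡2+[1+2k]3 ⟩
      2 + (1 + k * 2) * 3                ∎))
      where
      1≢2 : 1 ≢ 2
      1≢2 ()
      regroup : ∀ u k → 1 + (u + k + 1) * 3 ≡ u * 3 + 1 * (2 + (2 + k * 3))
      regroup = solve-∀

  b≡3n+2 : ∃[ n ] b ≡ 3 * n + 2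
  b≡3n+2 with g divMod 3
  ... | result k zero             g≡3k   = ⊥-elim (a∤g (divides k g≡3k))
  ... | result k (suc (suc zero)) g≡2+3k = ⊥-elim (g≢2+3k k g≡2+3k)
  ... | result k (suc zero)       g≡1+3k = k , (begin
    b         ≡⟨ ≤-antisym (b≤j+g z<s (s≤s (s≤s z≤n)) 3∤1+g) g<b ⟩
    suc g     ≡⟨ cong suc g≡1+3k ⟩
    2 + k * 3 ≡⟨ reorder k ⟩
    3 * k + 2 ∎)
    where
    open ≡-Reasoning
    3∤1+g : ¬ 3 ∣ 1 + g
    3∤1+g 3∣1+g = ∤-nonzero-remainder {q = k} (s≤s z≤n) (s≤s (s≤s (s≤s z≤n))) (subst (λ y → 3 ∣ suc y) g≡1+3k 3∣1+g)
    reorder : ∀ k → 2 + k * 3 ≡ 3 * k + 2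
    reorder = solve-∀

-- The two reflective families

module Generated⟨2,4n+3⟩ {S : Subset} (ns : IsNumericalSemigroup S) (n : ℕ)
                        (S≡⟨2,4n+3⟩ : IsGeneratedBy S 2 (4 * n + 3)) where
  open NumericalSemigroup ns
  open Generated S≡⟨2,4n+3⟩

  2g<b : (2 * n + 1) + (2 * n + 1) < 4 * n + 3
  2g<b = ≤-reflexive (double n)
    where
    double : ∀ n → suc ((2 * n + 1) + (2 * n + 1)) ≡ 4 * n + 3
    double = solve-∀

  reflectiveAt : ReflectiveAt S (2 * n + 1)
  reflectiveAt z z<g with z divMod 2
  ... | result q zero refl =
    xor-true-false (∣⇒∈ (divides q refl))
                   (∉-below-b (<-trans (+-monoˡ-< (2 * n + 1) z<g) 2g<b)
                              (λ 2∣ → ∤-nonzero-remainder {q = q + n} z<s (s≤s (s≤s z≤n)) (subst (2 ∣_) (odd q n) 2∣)))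
    where
    odd : ∀ q n → q * 2 + (2 * n + 1) ≡ 1 + (q + n) * 2
    odd = solve-∀
  ... | result q (suc zero) refl =
    xor-false-true (∉-below-b (<-trans z<g (<-trans (m<m+n _ (m≤n+m 1 (2 * n))) 2g<b))
                              (∤-nonzero-remainder {q = q} z<s (s≤s (s≤s z≤n))))
                   (∣⇒∈ (divides (q + n + 1) (even q n)))
    where
    even : ∀ q n → 1 + q * 2 + (2 * n + 1) ≡ (q + n + 1) * 2
    even = solve-∀

  full : ∀ t → ((2 * n + 1) + (2 * n + 1) + t) ∈ S
  full t with t divMod 2
  ... | result q zero       refl = ∣⇒∈ (divides (2 * n + 1 + q) (even n q))
    where
    even : ∀ n q → 2 * n + 1 + (2 * n + 1) + q * 2 ≡ (2 * n + 1 + q) * 2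
    even = solve-∀
  ... | result q (suc zero) refl = ∈⟨⟩⇒∈ (q , 1 , odd n q)
    where
    odd : ∀ n q → q * 2 + 1 * (4 * n + 3) ≡ 2 * n + 1 + (2 * n + 1) + (1 + q * 2)
    odd = solve-∀

  genus≡2n+1 : genus S ns ≡ 2 * n + 1
  genus≡2n+1 = genus-reflectiveAt (2 * n + 1) reflectiveAt full

  reflective : IsReflective S ns
  reflective = reflectiveAt⇒reflective (m≤n+m 1 (2 * n)) reflectiveAt full

module Generated⟨3,3n+2⟩ {S : Subset} (ns : IsNumericalSemigroup S) (n : ℕ)
                        (S≡⟨3,3n+2⟩ : IsGeneratedBy S 3 (3 * n + 2)) where
  open NumericalSemigroup ns
  open Generated S≡⟨3,3n+2⟩

  g<b : 3 * n + 1 < 3 * n + 2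
  g<b = +-monoʳ-< (3 * n) (n<1+n 1)

  -- Below 2b the elements of ⟨3,b⟩ have residue 0 or 2 modulo 3.
  residue-1-below-2b∉ : ∀ m → 1 + m * 3 < (3 * n + 2) + (3 * n + 2) → S (1 + m * 3) ≡ false
  residue-1-below-2b∉ m small = ∉⟨⟩⇒∉ impossible
    where
    impossible : (1 + m * 3) ∈⟨ 3 , 3 * n + 2 ⟩ → ⊥
    impossible (u , v , e) with b-coefficient-below-2b {3} {3 * n + 2} u {v} e small
    ... | z≤n     = ∤-nonzero-remainder {q = m} z<s (s≤s (s≤s z≤n)) (divides u (trans (sym e) (+-identityʳ (u * 3))))
    ... | s≤s z≤n = 2≢1 (remainder-unique {q = u + n} {p = m} (s≤s (s≤s (s≤s z≤n))) (s≤s (s≤s z≤n))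
                                          (trans (regroup u n) e))
      where
      2≢1 : 2 ≢ 1
      2≢1 ()
      regroup : ∀ u n → 2 + (u + n) * 3 ≡ u * 3 + 1 * (3 * n + 2)
      regroup = solve-∀

  reflectiveAt : ReflectiveAt S (3 * n + 1)
  reflectiveAt z z<g with z divMod 3
  ... | result q zero refl =
    xor-true-false (∣⇒∈ (divides q refl))
                   (subst (λ x → S x ≡ false) (sym (shift q n))
                          (residue-1-below-2b∉ (q + n) (subst (_< (3 * n + 2) + (3 * n + 2)) (shift q n)
                                                              (+-mono-< (<-trans z<g g<b) g<b))))
    where
    shift : ∀ q n → q * 3 + (3 * n + 1) ≡ 1 + (q + n) * 3
    shift = solve-∀
  ... | result q (suc zero) refl =
    xor-false-true (∉-below-b (<-trans z<g g<b) (∤-nonzero-remainder {q = q} z<s (s≤s (s≤s z≤n))))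
                   (∈⟨⟩⇒∈ (q , 1 , shift q n))
    where
    shift : ∀ q n → q * 3 + 1 * (3 * n + 2) ≡ 1 + q * 3 + (3 * n + 1)
    shift = solve-∀
  ... | result q (suc (suc zero)) refl =
    xor-false-true (∉-below-b (<-trans z<g g<b) (∤-nonzero-remainder {q = q} z<s (s≤s (s≤s (s≤s z≤n)))))
                   (∣⇒∈ (divides (q + n + 1) (shift q n)))
    where
    shift : ∀ q n → 2 + q * 3 + (3 * n + 1) ≡ (q + n + 1) * 3
    shift = solve-∀

  full : ∀ t → ((3 * n + 1) + (3 * n + 1) + t) ∈ S
  full t with t divMod 3
  ... | result q zero             refl = ∈⟨⟩⇒∈ (n + q , 1 , shift n q)
    where
    shift : ∀ n q → (n + q) * 3 + 1 * (3 * n + 2) ≡ 3 * n + 1 + (3 * n + 1) + q * 3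
    shift = solve-∀
  ... | result q (suc zero)       refl = ∣⇒∈ (divides (2 * n + 1 + q) (shift n q))
    where
    shift : ∀ n q → 3 * n + 1 + (3 * n + 1) + (1 + q * 3) ≡ (2 * n + 1 + q) * 3
    shift = solve-∀
  ... | result q (suc (suc zero)) refl = ∈⟨⟩⇒∈ (q , 2 , shift n q)
    where
    shift : ∀ n q → q * 3 + 2 * (3 * n + 2) ≡ 3 * n + 1 + (3 * n + 1) + (2 + q * 3)
    shift = solve-∀

  genus≡3n+1 : genus S ns ≡ 3 * n + 1
  genus≡3n+1 = genus-reflectiveAt (3 * n + 1) reflectiveAt full

  reflective : IsReflective S ns
  reflective = reflectiveAt⇒reflective (m≤n+m 1 (3 * n)) reflectiveAt full

Family : Subset → Set
Family S = ∃[ n ] (IsGeneratedBy S 2 (4 * n + 3) ⊎ IsGeneratedBy S 3 (3 * n + 2))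

reflective-by-multiplicity : ∀ {S} (ns : IsNumericalSemigroup S) → IsReflective S ns →
                             ∀ {a b} → 1 < a → a ≤ 3 → a < b → ¬ a ∣ b → IsGeneratedBy S a b → Family S
reflective-by-multiplicity {S} ns reflective (s≤s (s≤s z≤n)) (s≤s (s≤s z≤n)) a<b a∤b S≡⟨a,b⟩
  with ReflectiveWithMultiplicity2.b≡4n+3 ns reflective a<b a∤b S≡⟨a,b⟩
... | n , b≡4n+3 = n , inj₁ (subst (IsGeneratedBy S 2) b≡4n+3 S≡⟨a,b⟩)
reflective-by-multiplicity {S} ns reflective (s≤s (s≤s z≤n)) (s≤s (s≤s (s≤s z≤n))) a<b a∤b S≡⟨a,b⟩
  with ReflectiveWithMultiplicity3.b≡3n+2 ns reflective a<b a∤b S≡⟨a,b⟩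
... | n , b≡3n+2 = n , inj₂ (subst (IsGeneratedBy S 3) b≡3n+2 S≡⟨a,b⟩)

embeddingDimension2-reflective⇒family : ∀ {S} (ns : IsNumericalSemigroup S) → EmbeddingDimension2 S →
                                         IsReflective S ns → Family S
embeddingDimension2-reflective⇒family ns (zero    , _ , _   , a-min , _)              _          =
  ⊥-elim (proj₁ a-min refl)
embeddingDimension2-reflective⇒family ns (suc a , b , a<b , a-min , b-min , only) reflective =
  reflective-by-multiplicity ns reflective 1<a a≤3 a<b (a∤b a<b) generated
  where
  open TwoMinimalGenerators ns a-min b-min only
  open ReflectiveTwoGenerated ns reflective a<b (a∤b a<b) generated using (1<a; a≤3)

family⇒reflective : ∀ {S} (ns : IsNumericalSemigroup S) → Family S → IsReflective S ns
family⇒reflective ns (n , inj₁ S≡⟨2,4n+3⟩) = Generated⟨2,4n+3⟩.reflective ns n S≡⟨2,4n+3⟩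
family⇒reflective ns (n , inj₂ S≡⟨3,3n+2⟩) = Generated⟨3,3n+2⟩.reflective ns n S≡⟨3,3n+2⟩

corollary4p11 : (S : Subset) (ns : IsNumericalSemigroup S) → EmbeddingDimension2 S →
    (IsReflective S ns ⇔ (∃[ n ] (IsGeneratedBy S 2 (4 * n + 3) ⊎ IsGeneratedBy S 3 (3 * n + 2))))
    × (∀ n → IsGeneratedBy S 2 (4 * n + 3) → genus S ns ≡ 2 * n + 1)
    × (∀ n → IsGeneratedBy S 3 (3 * n + 2) → genus S ns ≡ 3 * n + 1)
corollary4p11 S ns ed₂ =
  mk⇔ (embeddingDimension2-reflective⇒family ns ed₂) (family⇒reflective ns) ,
  Generated⟨2,4n+3⟩.genus≡2n+1 ns ,
  Generated⟨3,3n+2⟩.genus≡3n+1 ns
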